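{- Let $\Sigma$ be an alphabet and $\Sigma^\ast$ the set of finite words over $\Sigma$, with empty word $\varepsilon$. Define ternary relations on $\Sigma^\ast$ by $R^x_{yz}\Leftrightarrow x=y\cdot z$ (concatenation) and $S^x_{yz}\Leftrightarrow x\in y\| z$ (shuffle). Then $(\Sigma^\ast,R,S,\{\varepsilon\})$ is a relational interchange monoid and $S$ is relationally commutative, i.e. $S^x_{uv}\Rightarrow S^x_{vu}$ for all $x,u,v$.
   Context: The shuffle $\|:\Sigma^\ast\times\Sigma^\ast\to\mathcal{P}(\Sigma^\ast)$ is defined recursively by $v\|\varepsilon=\{v\}=\varepsilon\| v$ and $(av)\|(bw)=\{a\}\cdot(v\|(bw))\cup\{b\}\cdot((av)\|w)$ for letters $a,b$ and words $v,w$, where $\{a\}\cdot L=\{au\mid u\in L\}$. A relational interchange monoid $(X,R,S,E)$: $R,S$ ternary relations on $X$ (write $R^x_{yz}$), each relationally associative (for all $x,u,v,w$: $(\exists y.\ R^y_{uv}\wedge R^x_{yw})\Leftrightarrow(\exists y.\ R^x_{uy}\wedge R^y_{vw})$, likewise $S$), $E$ a set of relational units for both (for all $x,y$: $\exists e\in E.\ R^x_{ex}$; $R^x_{ey}\wedge e\in E\Rightarrow x=y$; $\exists e\in E.\ R^x_{xe}$; $R^x_{ye}\wedge e\in E\Rightarrow x=y$; likewise $S$), and for all $t,u,v,w,x$: $(\exists y,z.\ S^y_{tu}\wedge R^x_{yz}\wedge S^z_{vw})\Rightarrow(\exists y,z.\ R^y_{tv}\wedge S^x_{yz}\wedge R^z_{uw})$.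 -}

module Defs where

open import Level using (Level; _⊔_; suc)
open import Data.List using (List; []; _∷_; _++_; map)
open import Data.List.Membership.Propositional using (_∈_)
open import Data.Product using (Σ; ∃; ∃-syntax; _×_; _,_)
open import Function.Bundles using (_⇔_)
open import Relation.Binary.PropositionalEquality using (_≡_)

-- Ternary relation on X, written  T x y z  for  T^x_{yz}.
TRel : ∀ {a} (X : Set a) → Set (suc a)
TRel {a} X = X → X → X → Set a

RelAssoc : ∀ {a} {X : Set a} → TRel X → Set a
RelAssoc {X = X} T = ∀ x u v w →
  (∃[ y ] (T y u v × T x y w)) ⇔ (∃[ y ] (T x u y × T y v w))

RelUnits : ∀ {a} {X : Set a} → TRel X → (X → Set a) → Set a
RelUnits {X = X} T E =
    (∀ x → ∃[ e ] (E e × T x e x))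
  × (∀ x y e → T x e y → E e → x ≡ y)
  × (∀ x → ∃[ e ] (E e × T x x e))
  × (∀ x y e → T x y e → E e → x ≡ y)

RelInterchange : ∀ {a} {X : Set a} → TRel X → TRel X → Set a
RelInterchange {X = X} R S = ∀ t u v w x →
  (∃[ y ] ∃[ z ] (S y t u × R x y z × S z v w)) →
  (∃[ y ] ∃[ z ] (R y t v × S x y z × R z u w))

record IsRelInterchangeMonoid {a} (X : Set a) (R S : TRel X) (E : X → Set a)
       : Set a where
  field
    R-assoc     : RelAssoc R
    S-assoc     : RelAssoc S
    R-units     : RelUnits R E
    S-units     : RelUnits S E
    interchange : RelInterchange R S

RelComm : ∀ {a} {X : Set a} → TRel X → Set a
RelComm T = ∀ x u v → T x u v → T x v u

-- Shuffle of words, as a finite list enumerating the set v ‖ w.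
_‖_ : ∀ {a} {A : Set a} → List A → List A → List (List A)
[]      ‖ w       = w ∷ []
(x ∷ v) ‖ []      = (x ∷ v) ∷ []
(x ∷ v) ‖ (y ∷ w) = map (x ∷_) (v ‖ (y ∷ w)) ++ map (y ∷_) ((x ∷ v) ‖ w)

ConcatRel : ∀ {a} (A : Set a) → TRel (List A)
ConcatRel A x y z = x ≡ y ++ z

ShuffleRel : ∀ {a} (A : Set a) → TRel (List A)
ShuffleRel A x y z = x ∈ y ‖ z

IsEmptyWord : ∀ {a} (A : Set a) → List A → Set a
IsEmptyWord A x = x ≡ []

module Submission where

-- The shuffle set  u ‖ v  of Defs is an enumerating list, which is awkward to
-- reason about.  We therefore first show that membership  x ∈ u ‖ v  is
-- equivalent to the library's inductive relation  Interleaving u v x  ("x is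
-- an order-preserving merge of u and v").  Every law is then proved for
-- interleavings by structural induction and transported back:
--   * commutativity is the library's  swap ;
--   * the empty word is a two-sided unit, and interleaving with [] is trivial;
--   * associativity: merging u,v into y and then y,w into x can be
--     reorganised as merging v,w into y' and then u,y' into x (the converse
--     follows by symmetry, using commutativity);
--   * interchange: concatenating two merges is a merge of the concatenations
--     (the library's  ++⁺ ).

open import Defs
open import Data.List using (List; []; _∷_; _++_; map)
open import Data.List.Properties using (++-assoc; ++-identityʳ)
open import Data.List.Membership.Propositional using (_∈_)
open import Data.List.Membership.Propositional.Properties
  using (∈-++⁻; ∈-++⁺ˡ; ∈-++⁺ʳ; ∈-map⁻; ∈-map⁺)
open import Data.List.Relation.Unary.Any using (here)
import Data.List.Relation.Binary.Pointwise.Properties as Pointwise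
open import Data.List.Relation.Ternary.Interleaving.Propositional
  using (Interleaving; []; consˡ; consʳ; left; right; swap)
open import Data.List.Relation.Ternary.Interleaving.Properties
  using (++⁺)
open import Data.Product using (_×_; _,_; ∃-syntax)
open import Data.Sum using (inj₁; inj₂)
open import Function.Bundles using (mk⇔)
open import Relation.Binary.PropositionalEquality using (_≡_; refl; sym; cong)

module _ {a} {A : Set a} where

  interleave-[]ʳ : ∀ (u : List A) → Interleaving u [] u
  interleave-[]ʳ u = left (Pointwise.refl refl)

  interleave-[]ˡ : ∀ (v : List A) → Interleaving [] v v
  interleave-[]ˡ v = right (Pointwise.refl refl)

  interleave-[]ʳ⁻¹ : ∀ {u x : List A} → Interleaving u [] x → x ≡ u
  interleave-[]ʳ⁻¹ []         = refl
  interleave-[]ʳ⁻¹ (consˡ sp) = cong (_ ∷_) (interleave-[]ʳ⁻¹ sp)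

  interleave-[]ˡ⁻¹ : ∀ {v x : List A} → Interleaving [] v x → x ≡ v
  interleave-[]ˡ⁻¹ sp = interleave-[]ʳ⁻¹ (swap sp)

  ‖⇒interleaving : ∀ (u v : List A) {x} → x ∈ u ‖ v → Interleaving u v x
  ‖⇒interleaving []      v       (here refl) = interleave-[]ˡ v
  ‖⇒interleaving (b ∷ u) []      (here refl) = interleave-[]ʳ (b ∷ u)
  ‖⇒interleaving (b ∷ u) (c ∷ v) x∈
    with ∈-++⁻ (map (b ∷_) (u ‖ (c ∷ v))) x∈
  ... | inj₁ x∈ˡ with ∈-map⁻ (b ∷_) x∈ˡ
  ...   | _ , x′∈ , refl = consˡ (‖⇒interleaving u (c ∷ v) x′∈)
  ‖⇒interleaving (b ∷ u) (c ∷ v) x∈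
      | inj₂ x∈ʳ with ∈-map⁻ (c ∷_) x∈ʳ
  ...   | _ , x′∈ , refl = consʳ (‖⇒interleaving (b ∷ u) v x′∈)

  interleaving⇒‖ : ∀ {u v x : List A} → Interleaving u v x → x ∈ u ‖ v
  interleaving⇒‖ []                       = here refl
  interleaving⇒‖ {v = []}    (consˡ sp)   = here (cong (_ ∷_) (interleave-[]ʳ⁻¹ sp))
  interleaving⇒‖ {v = _ ∷ _} (consˡ sp)   = ∈-++⁺ˡ (∈-map⁺ _ (interleaving⇒‖ sp))
  interleaving⇒‖ {u = []}    (consʳ sp)   = here (cong (_ ∷_) (interleave-[]ˡ⁻¹ sp))
  interleaving⇒‖ {u = b ∷ u} (consʳ sp)   =
    ∈-++⁺ʳ (map (b ∷_) (u ‖ _)) (∈-map⁺ _ (interleaving⇒‖ sp))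

  interleave-reassocʳ : ∀ {u v w y x : List A} →
    Interleaving u v y → Interleaving y w x →
    ∃[ y′ ] (Interleaving u y′ x × Interleaving v w y′)
  interleave-reassocʳ [] [] = [] , [] , []
  interleave-reassocʳ sp (consʳ sp′) with interleave-reassocʳ sp sp′
  ... | y′ , outer , inner = _ , consʳ outer , consʳ inner
  interleave-reassocʳ (consˡ sp) (consˡ sp′) with interleave-reassocʳ sp sp′
  ... | y′ , outer , inner = y′ , consˡ outer , inner
  interleave-reassocʳ (consʳ sp) (consˡ sp′) with interleave-reassocʳ sp sp′
  ... | y′ , outer , inner = _ , consʳ outer , consˡ inner

  interleave-reassocˡ : ∀ {u v w y x : List A} →
    Interleaving u y x → Interleaving v w y →
    ∃[ y′ ] (Interleaving u v y′ × Interleaving y′ w x)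
  interleave-reassocˡ outer inner with interleave-reassocʳ (swap inner) (swap outer)
  ... | y′ , outer′ , inner′ = y′ , swap inner′ , swap outer′

  shuffle-comm : RelComm (ShuffleRel A)
  shuffle-comm x u v x∈ = interleaving⇒‖ (swap (‖⇒interleaving u v x∈))

  shuffle-units : RelUnits (ShuffleRel A) (IsEmptyWord A)
  shuffle-units =
      (λ x → [] , refl , interleaving⇒‖ (interleave-[]ˡ x))
    , (λ { x y e x∈ refl → interleave-[]ˡ⁻¹ (‖⇒interleaving [] y x∈) })
    , (λ x → [] , refl , interleaving⇒‖ (interleave-[]ʳ x))
    , (λ { x y e x∈ refl → interleave-[]ʳ⁻¹ (‖⇒interleaving y [] x∈) })

  shuffle-assoc : RelAssoc (ShuffleRel A)
  shuffle-assoc x u v w = mk⇔ reassocʳ reassocˡ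
    where
    reassocʳ : ∃[ y ] (ShuffleRel A y u v × ShuffleRel A x y w) →
               ∃[ y ] (ShuffleRel A x u y × ShuffleRel A y v w)
    reassocʳ (y , y∈ , x∈)
      with interleave-reassocʳ (‖⇒interleaving u v y∈) (‖⇒interleaving y w x∈)
    ... | y′ , outer , inner = y′ , interleaving⇒‖ outer , interleaving⇒‖ inner

    reassocˡ : ∃[ y ] (ShuffleRel A x u y × ShuffleRel A y v w) →
               ∃[ y ] (ShuffleRel A y u v × ShuffleRel A x y w)
    reassocˡ (y , x∈ , y∈)
      with interleave-reassocˡ (‖⇒interleaving u y x∈) (‖⇒interleaving v w y∈)
    ... | y′ , inner , outer = y′ , interleaving⇒‖ inner , interleaving⇒‖ outer

  concat-assoc : RelAssoc (ConcatRel A)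
  concat-assoc x u v w = mk⇔
    (λ { (_ , refl , refl) → v ++ w , ++-assoc u v w , refl })
    (λ { (_ , refl , refl) → u ++ v , refl , sym (++-assoc u v w) })

  concat-units : RelUnits (ConcatRel A) (IsEmptyWord A)
  concat-units =
      (λ x → [] , refl , refl)
    , (λ { x y e refl refl → refl })
    , (λ x → [] , refl , sym (++-identityʳ x))
    , (λ { x y e refl refl → ++-identityʳ y })

  concat-shuffle-interchange : RelInterchange (ConcatRel A) (ShuffleRel A)
  concat-shuffle-interchange t u v w x (y , z , y∈ , refl , z∈) =
    t ++ v , u ++ w , refl ,
    interleaving⇒‖ (++⁺ (‖⇒interleaving t u y∈) (‖⇒interleaving v w z∈)) , refl

lemma8p1 : (Alph : Set)
    → IsRelInterchangeMonoid (List Alph) (ConcatRel Alph) (ShuffleRel Alph) (IsEmptyWord Alph)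
      × RelComm (ShuffleRel Alph)
lemma8p1 Alph = words-interchange-monoid , shuffle-comm
  where
  words-interchange-monoid :
    IsRelInterchangeMonoid (List Alph) (ConcatRel Alph) (ShuffleRel Alph) (IsEmptyWord Alph)
  words-interchange-monoid = record
    { R-assoc     = concat-assoc
    ; S-assoc     = shuffle-assoc
    ; R-units     = concat-units
    ; S-units     = shuffle-units
    ; interchange = concat-shuffle-interchange
    }
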